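{- Let $n,k,t,r$ be positive integers with $r\geq 2$, $n\geq 2k$ and $k>t+r-2$. Let $M\in\binom{[n]}{k+1}$, $X\in\binom{M}{t+r-2}$ and $Z\in\binom{[n]}{t+r}$. Then both $\mathcal{A}(k,t+r-1,Z)$ and $\mathcal{H}(k,t+r-1,X,M)$ are non-trivial $r$-wise $t$-intersecting families.
   Context: $[n]=\{1,\dots,n\}$; $\binom{V}{k}$ is the family of $k$-subsets of $V$. A family $\mathcal{F}\subseteq\binom{[n]}{k}$ is $r$-wise $t$-intersecting if $|F_1\cap\cdots\cap F_r|\geq t$ for all $F_1,\dots,F_r\in\mathcal{F}$; it is trivial if all its members contain a common $t$-subset of $[n]$, and non-trivial otherwise. With $d=t+r-2$: $\mathcal{H}(k,d+1,X,M)=\{H\in\binom{[n]}{k}: X\subseteq H,\ |H\cap M|\geq d+1\}\cup\binom{M}{k}$ and $\mathcal{A}(k,d+1,Z)=\{A\in\binom{[n]}{k}: |A\cap Z|\geq d+1\}$. -}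

module Defs where

open import Data.Nat using (ℕ; _≤_; _+_; _∸_)
open import Data.Fin using (Fin)
open import Data.Fin.Subset using (Subset; _⊆_; _∩_; ∣_∣; ⋂)
open import Data.Vec using (toList; tabulate)
open import Data.Product using (_×_; Σ-syntax)
open import Data.Sum using (_⊎_)
open import Relation.Nullary using (¬_)
open import Relation.Binary.PropositionalEquality using (_≡_)
open import Level using (0ℓ; suc)

-- Ground set [n] is represented by Fin n; subsets of [n] by Data.Fin.Subset.
-- A family of subsets of [n] is a predicate on Subset n.
Family : ℕ → Set₁
Family n = Subset n → Set

IsKUniform : ∀ {n} → ℕ → Family n → Set
IsKUniform k 𝓕 = ∀ F → 𝓕 F → ∣ F ∣ ≡ k

⋂ᶠ : ∀ {n r} → (Fin r → Subset n) → Subset n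
⋂ᶠ {r = r} F = ⋂ (toList (tabulate F))

RWiseTIntersecting : ∀ {n} → ℕ → ℕ → Family n → Set
RWiseTIntersecting r t 𝓕 =
  (F : Fin r → Subset _) → (∀ i → 𝓕 (F i)) → t ≤ ∣ ⋂ᶠ F ∣

Trivial : ∀ {n} → ℕ → Family n → Set
Trivial {n} t 𝓕 = Σ[ T ∈ Subset n ] (∣ T ∣ ≡ t × (∀ F → 𝓕 F → T ⊆ F))

NonTrivial : ∀ {n} → ℕ → Family n → Set
NonTrivial t 𝓕 = ¬ Trivial t 𝓕

𝓗 : ∀ {n} → ℕ → ℕ → Subset n → Subset n → Family n
𝓗 k s X M H = ∣ H ∣ ≡ k × ((X ⊆ H × s ≤ ∣ H ∩ M ∣) ⊎ H ⊆ M)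

𝓐 : ∀ {n} → ℕ → ℕ → Subset n → Family n
𝓐 k s Z A = ∣ A ∣ ≡ k × s ≤ ∣ A ∩ Z ∣

-- Every member of 𝓐(k, t+r-1, Z) misses at most one point of Z and |Z| = t+r, so any r members
-- still share t points of Z. For 𝓗 the same counting runs inside M (|M| = k+1) when all r members
-- are k-subsets of M. Otherwise some member H contains X and, as |H ∩ M| > |X|, one more point of
-- M; this set S of size t+r-1 lies in H and misses at most one point of every member (those
-- containing X miss only the extra point, k-subsets of M miss one point of M), so the r-1 other
-- members still share t points of S. Neither family is trivial since every point is avoided by a
-- member: n ≥ k+1 and |M| = k+1 leave room for one.
module Submission where

open import Defs
open import Data.Nat using (ℕ; zero; suc; _≤_; _<_; _+_; _∸_; _*_; z≤n; s≤s)
open import Data.Nat.Properties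
open import Algebra.Properties.CommutativeMonoid.Sum +-0-commutativeMonoid
  using (sum; sum-syntax; sum-remove)
open import Data.Fin using (Fin; zero; suc; punchIn)
open import Data.Fin.Properties using (all?; ¬∀⟶∃¬)
open import Data.Fin.Subset
open import Data.Fin.Subset.Properties
open import Data.Vec using ([]; _∷_; here; there)
open import Data.Product using (_×_; _,_; proj₁; proj₂; Σ-syntax)
open import Data.Sum using (inj₁; inj₂)
open import Function using (_∘_)
open import Relation.Nullary using (yes; no; contradiction)
open import Relation.Binary.PropositionalEquality

private
  variable
    n : ℕ
    p q r : Subset n
    x : Fin n

∣p∣≡∣p∩q∣+∣p─q∣ : ∀ (p q : Subset n) → ∣ p ∣ ≡ ∣ p ∩ q ∣ + ∣ p ─ q ∣
∣p∣≡∣p∩q∣+∣p─q∣ []            []            = refl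
∣p∣≡∣p∩q∣+∣p─q∣ (outside ∷ p) (inside  ∷ q) = ∣p∣≡∣p∩q∣+∣p─q∣ p q
∣p∣≡∣p∩q∣+∣p─q∣ (outside ∷ p) (outside ∷ q) = ∣p∣≡∣p∩q∣+∣p─q∣ p q
∣p∣≡∣p∩q∣+∣p─q∣ (inside  ∷ p) (inside  ∷ q) = cong suc (∣p∣≡∣p∩q∣+∣p─q∣ p q)
∣p∣≡∣p∩q∣+∣p─q∣ (inside  ∷ p) (outside ∷ q) =
  trans (cong suc (∣p∣≡∣p∩q∣+∣p─q∣ p q)) (sym (+-suc _ _))

x∈p─q⇒x∉q : x ∈ p ─ q → x ∉ q
x∈p─q⇒x∉q {p = inside ∷ p} {q = outside ∷ q} here        ()
x∈p─q⇒x∉q {p = _      ∷ p} {q = inside  ∷ q} (there x∈) (there x∈q) = x∈p─q⇒x∉q x∈ x∈q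
x∈p─q⇒x∉q {p = _      ∷ p} {q = outside ∷ q} (there x∈) (there x∈q) = x∈p─q⇒x∉q x∈ x∈q

x∉p-x : x ∉ p - x
x∉p-x {x = x} x∈p-x = x∈p─q⇒x∉q x∈p-x (x∈⁅x⁆ x)

p⊆q⇒p─r⊆q─r : p ⊆ q → p ─ r ⊆ q ─ r
p⊆q⇒p─r⊆q─r {p = p} {r = r} p⊆q x∈p─r =
  x∈p∧x∉q⇒x∈p─q (p⊆q (p─q⊆p p r x∈p─r)) (x∈p─q⇒x∉q x∈p─r)

p⊆q⇒∣p─q∣≡0 : p ⊆ q → ∣ p ─ q ∣ ≡ 0
p⊆q⇒∣p─q∣≡0 {n} {p} {q} p⊆q = begin
  ∣ p ─ q ∣   ≡⟨ cong ∣_∣ (Empty-unique λ (_ , x∈p─q) →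
                   x∈p─q⇒x∉q x∈p─q (p⊆q (p─q⊆p p q x∈p─q))) ⟩
  ∣ ⊥ {n} ∣   ≡⟨ ∣⊥∣≡0 n ⟩
  0           ∎
  where open ≡-Reasoning

∣p∣≤∣q∣+∣p─q∣ : ∀ (p q : Subset n) → ∣ p ∣ ≤ ∣ q ∣ + ∣ p ─ q ∣
∣p∣≤∣q∣+∣p─q∣ p q =
  ≤-trans (≤-reflexive (∣p∣≡∣p∩q∣+∣p─q∣ p q)) (+-monoˡ-≤ ∣ p ─ q ∣ (∣p∩q∣≤∣q∣ p q))

∣p∣≤1+∣p-x∣ : ∀ (p : Subset n) x → ∣ p ∣ ≤ suc ∣ p - x ∣
∣p∣≤1+∣p-x∣ p x = subst (λ m → ∣ p ∣ ≤ m + ∣ p - x ∣) (∣⁅x⁆∣≡1 x) (∣p∣≤∣q∣+∣p─q∣ p ⁅ x ⁆)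

∣p─q∣≤1 : ∀ (p q : Subset n) → ∣ p ∣ ≤ suc ∣ p ∩ q ∣ → ∣ p ─ q ∣ ≤ 1
∣p─q∣≤1 p q ∣p∣≤1+∣p∩q∣ = +-cancelˡ-≤ ∣ p ∩ q ∣ ∣ p ─ q ∣ 1 (begin
  ∣ p ∩ q ∣ + ∣ p ─ q ∣ ≡⟨ ∣p∣≡∣p∩q∣+∣p─q∣ p q ⟨
  ∣ p ∣                 ≤⟨ ∣p∣≤1+∣p∩q∣ ⟩
  suc ∣ p ∩ q ∣         ≡⟨ +-comm 1 ∣ p ∩ q ∣ ⟩
  ∣ p ∩ q ∣ + 1         ∎)
  where open ≤-Reasoning

q⊆p⇒∣p─q∣≤1 : ∀ {k} → ∣ p ∣ ≡ suc k → ∣ q ∣ ≡ k → q ⊆ p → ∣ p ─ q ∣ ≤ 1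
q⊆p⇒∣p─q∣≤1 {p = p} {q = q} ∣p∣≡1+k ∣q∣≡k q⊆p = ∣p─q∣≤1 p q (begin
  ∣ p ∣         ≡⟨ trans ∣p∣≡1+k (cong suc (sym ∣q∣≡k)) ⟩
  suc ∣ q ∣     ≤⟨ s≤s (p⊆q⇒∣p∣≤∣q∣ λ x∈q → x∈p∩q⁺ (q⊆p x∈q , x∈q)) ⟩
  suc ∣ p ∩ q ∣ ∎)
  where open ≤-Reasoning

0<∣p∣⇒Nonempty : 0 < ∣ p ∣ → Nonempty p
0<∣p∣⇒Nonempty {p = inside  ∷ p} _  = zero , here
0<∣p∣⇒Nonempty {p = outside ∷ p} 0<∣p∣ with 0<∣p∣⇒Nonempty 0<∣p∣
... | x , x∈p = suc x , there x∈p

⊆-extend : ∀ k → p ⊆ q → ∣ p ∣ ≤ k → k ≤ ∣ q ∣ → Σ[ r ∈ Subset n ] (p ⊆ r × r ⊆ q × ∣ r ∣ ≡ k)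
⊆-extend {p = []} {q = []} k _ _ k≤0 = [] , ⊆-refl , ⊆-refl , sym (n≤0⇒n≡0 k≤0)
⊆-extend {p = inside ∷ p} {q = outside ∷ q} k p⊆q = contradiction (p⊆q here) λ ()
⊆-extend {p = outside ∷ p} {q = outside ∷ q} k p⊆q ∣p∣≤k k≤∣q∣
  with ⊆-extend k (drop-∷-⊆ p⊆q) ∣p∣≤k k≤∣q∣
... | r , p⊆r , r⊆q , ∣r∣≡k = outside ∷ r , s⊆s p⊆r , s⊆s r⊆q , ∣r∣≡k
⊆-extend {p = inside ∷ p} {q = inside ∷ q} (suc k) p⊆q (s≤s ∣p∣≤k) (s≤s k≤∣q∣)
  with ⊆-extend k (drop-∷-⊆ p⊆q) ∣p∣≤k k≤∣q∣
... | r , p⊆r , r⊆q , ∣r∣≡k = inside ∷ r , s⊆s p⊆r , s⊆s r⊆q , cong suc ∣r∣≡k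
⊆-extend {p = outside ∷ p} {q = inside ∷ q} k p⊆q ∣p∣≤k k≤∣q∣ with m≤n⇒m<n∨m≡n k≤∣q∣
... | inj₂ refl = inside ∷ q , p⊆q , ⊆-refl , refl
... | inj₁ (s≤s k≤∣q∣′) with ⊆-extend k (drop-∷-⊆ p⊆q) ∣p∣≤k k≤∣q∣′
...   | r , p⊆r , r⊆q , ∣r∣≡k = outside ∷ r , s⊆s p⊆r , out⊆ r⊆q , ∣r∣≡k

subset-of-size : ∀ k → k ≤ ∣ q ∣ → Σ[ r ∈ Subset n ] (r ⊆ q × ∣ r ∣ ≡ k)
subset-of-size {n} k k≤∣q∣ with ⊆-extend k ⊥⊆ (subst (_≤ k) (sym (∣⊥∣≡0 n)) z≤n) k≤∣q∣
... | r , _ , r⊆q , ∣r∣≡k = r , r⊆q , ∣r∣≡k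

sum≤n : ∀ {n} (f : Fin n → ℕ) → (∀ i → f i ≤ 1) → sum f ≤ n
sum≤n {zero}  f f≤1 = z≤n
sum≤n {suc n} f f≤1 = +-mono-≤ (f≤1 zero) (sum≤n (f ∘ suc) (f≤1 ∘ suc))

sum<n : ∀ {n} (f : Fin n → ℕ) → (∀ i → f i ≤ 1) → ∀ i → f i ≡ 0 → sum f < n
sum<n {suc n} f f≤1 i fi≡0 = begin-strict
  sum f                     ≡⟨ sum-remove f ⟩
  f i + sum (f ∘ punchIn i) ≡⟨ cong (_+ sum (f ∘ punchIn i)) fi≡0 ⟩
  sum (f ∘ punchIn i)       ≤⟨ sum≤n (f ∘ punchIn i) (f≤1 ∘ punchIn i) ⟩
  n                         <⟨ n<1+n n ⟩
  suc n                     ∎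
  where open ≤-Reasoning

⋂ᶠ-union-bound : ∀ {m} (p : Subset n) (F : Fin m → Subset n) →
                 ∣ p ∣ ≤ ∣ p ∩ ⋂ᶠ F ∣ + ∑[ i < m ] ∣ p ─ F i ∣
⋂ᶠ-union-bound {m = zero} p F =
  ≤-reflexive (trans (cong ∣_∣ (sym (∩-identityʳ p))) (sym (+-identityʳ _)))
⋂ᶠ-union-bound {m = suc m} p F = begin
  ∣ p ∣                                        ≤⟨ ⋂ᶠ-union-bound p (F ∘ suc) ⟩
  ∣ p ∩ P ∣ + Σ                                ≡⟨ cong (_+ Σ) (∣p∣≡∣p∩q∣+∣p─q∣ (p ∩ P) (F zero)) ⟩
  ∣ (p ∩ P) ∩ F zero ∣ + ∣ p ∩ P ─ F zero ∣ + Σ ≤⟨ +-monoˡ-≤ Σ (+-mono-≤ (≤-reflexive (cong ∣_∣ reassoc))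
                                                   (p⊆q⇒∣p∣≤∣q∣ (p⊆q⇒p─r⊆q─r {r = F zero} (p∩q⊆p p P)))) ⟩
  ∣ p ∩ ⋂ᶠ F ∣ + ∣ p ─ F zero ∣ + Σ            ≡⟨ +-assoc ∣ p ∩ ⋂ᶠ F ∣ ∣ p ─ F zero ∣ Σ ⟩
  ∣ p ∩ ⋂ᶠ F ∣ + ∑[ i < suc m ] ∣ p ─ F i ∣    ∎
  where
  open ≤-Reasoning
  P = ⋂ᶠ (F ∘ suc)
  Σ = ∑[ i < m ] ∣ p ─ F (suc i) ∣
  reassoc : (p ∩ P) ∩ F zero ≡ p ∩ ⋂ᶠ F
  reassoc = trans (∩-assoc p P (F zero)) (cong (p ∩_) (∩-comm P (F zero)))

⋂ᶠ-lower-bound : ∀ {m} t (p : Subset n) (F : Fin m → Subset n) →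
                 (∀ i → ∣ p ─ F i ∣ ≤ 1) → t + m ≤ ∣ p ∣ → t ≤ ∣ ⋂ᶠ F ∣
⋂ᶠ-lower-bound {m = m} t p F ∣p─F∣≤1 t+m≤∣p∣ = +-cancelʳ-≤ m t ∣ ⋂ᶠ F ∣ (begin
  t + m                                    ≤⟨ t+m≤∣p∣ ⟩
  ∣ p ∣                                    ≤⟨ ⋂ᶠ-union-bound p F ⟩
  ∣ p ∩ ⋂ᶠ F ∣ + ∑[ i < m ] ∣ p ─ F i ∣    ≤⟨ +-mono-≤ (∣p∩q∣≤∣q∣ p (⋂ᶠ F)) (sum≤n _ ∣p─F∣≤1) ⟩
  ∣ ⋂ᶠ F ∣ + m                             ∎)
  where open ≤-Reasoning

⋂ᶠ-lower-bound-⊆ : ∀ {m} t (p : Subset n) (F : Fin m → Subset n) →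
                   (∀ i → ∣ p ─ F i ∣ ≤ 1) → ∀ i → p ⊆ F i → t + m ≤ suc ∣ p ∣ → t ≤ ∣ ⋂ᶠ F ∣
⋂ᶠ-lower-bound-⊆ {m = m} t p F ∣p─F∣≤1 i p⊆Fi t+m≤1+∣p∣ = +-cancelʳ-≤ m t ∣ ⋂ᶠ F ∣ (begin
  t + m                                          ≤⟨ t+m≤1+∣p∣ ⟩
  suc ∣ p ∣                                      ≤⟨ s≤s (⋂ᶠ-union-bound p F) ⟩
  suc (∣ p ∩ ⋂ᶠ F ∣ + Σ)                         ≤⟨ s≤s (+-monoˡ-≤ Σ (∣p∩q∣≤∣q∣ p (⋂ᶠ F))) ⟩
  suc (∣ ⋂ᶠ F ∣ + Σ)                             ≡⟨ +-suc ∣ ⋂ᶠ F ∣ Σ ⟨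
  ∣ ⋂ᶠ F ∣ + suc Σ                               ≤⟨ +-monoʳ-≤ ∣ ⋂ᶠ F ∣ (sum<n _ ∣p─F∣≤1 i (p⊆q⇒∣p─q∣≡0 p⊆Fi)) ⟩
  ∣ ⋂ᶠ F ∣ + m                                   ∎)
  where
  open ≤-Reasoning
  Σ = ∑[ i < m ] ∣ p ─ F i ∣

avoidable⇒NonTrivial : ∀ {t} {𝓕 : Family n} → 1 ≤ t →
                       (∀ x → Σ[ F ∈ Subset n ] (𝓕 F × x ∉ F)) → NonTrivial t 𝓕
avoidable⇒NonTrivial 1≤t avoiding (T , ∣T∣≡t , T⊆𝓕) =
  let x , x∈T      = 0<∣p∣⇒Nonempty (subst (1 ≤_) (sym ∣T∣≡t) 1≤t)
      F , F∈𝓕 , x∉F = avoiding x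
  in  x∉F (T⊆𝓕 F F∈𝓕 x∈T)

𝓐-intersecting : ∀ r t k s (Z : Subset n) → ∣ Z ∣ ≤ suc s → t + r ≤ ∣ Z ∣ →
                 RWiseTIntersecting r t (𝓐 k s Z)
𝓐-intersecting r t k s Z ∣Z∣≤1+s t+r≤∣Z∣ F F∈𝓐 = ⋂ᶠ-lower-bound t Z F ∣Z─F∣≤1 t+r≤∣Z∣
  where
  ∣Z─F∣≤1 : ∀ i → ∣ Z ─ F i ∣ ≤ 1
  ∣Z─F∣≤1 i = ∣p─q∣≤1 Z (F i)
    (≤-trans ∣Z∣≤1+s (s≤s (subst (λ A → s ≤ ∣ A ∣) (∩-comm (F i) Z) (proj₂ (F∈𝓐 i)))))

𝓐-nonTrivial : ∀ t k s (Z : Subset n) → 1 ≤ t → s ≤ k → suc k ≤ n → suc s ≤ ∣ Z ∣ →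
               NonTrivial t (𝓐 k s Z)
𝓐-nonTrivial {n} t k s Z 1≤t s≤k 1+k≤n 1+s≤∣Z∣ = avoidable⇒NonTrivial 1≤t avoiding
  where
  avoiding : ∀ x → Σ[ A ∈ Subset n ] (𝓐 k s Z A × x ∉ A)
  avoiding x =
    let S , S⊆Z-x , ∣S∣≡s = subset-of-size s (≤-pred (≤-trans 1+s≤∣Z∣ (∣p∣≤1+∣p-x∣ Z x)))
        k≤∣⊤-x∣ = ≤-pred (≤-trans 1+k≤n (subst (_≤ suc ∣ ⊤ - x ∣) (∣⊤∣≡n n) (∣p∣≤1+∣p-x∣ ⊤ x)))
        A , S⊆A , A⊆⊤-x , ∣A∣≡k =
          ⊆-extend k (p⊆q⇒p─r⊆q─r ⊆⊤ ∘ S⊆Z-x) (≤-trans (≤-reflexive ∣S∣≡s) s≤k) k≤∣⊤-x∣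
        S⊆A∩Z : S ⊆ A ∩ Z
        S⊆A∩Z y∈S = x∈p∩q⁺ (S⊆A y∈S , p─q⊆p Z ⁅ x ⁆ (S⊆Z-x y∈S))
    in  A , (∣A∣≡k , subst (_≤ ∣ A ∩ Z ∣) ∣S∣≡s (p⊆q⇒∣p∣≤∣q∣ S⊆A∩Z)) , x∉p-x ∘ A⊆⊤-x

𝓗-nonTrivial : ∀ t k s (X M : Subset n) → 1 ≤ t → ∣ M ∣ ≡ suc k → NonTrivial t (𝓗 k s X M)
𝓗-nonTrivial {n} t k s X M 1≤t ∣M∣≡1+k = avoidable⇒NonTrivial 1≤t avoiding
  where
  avoiding : ∀ x → Σ[ H ∈ Subset n ] (𝓗 k s X M H × x ∉ H)
  avoiding x =
    let H , H⊆M-x , ∣H∣≡k = subset-of-size k (≤-pred (subst (_≤ suc ∣ M - x ∣) ∣M∣≡1+k (∣p∣≤1+∣p-x∣ M x)))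
    in  H , (∣H∣≡k , inj₂ (p─q⊆p M ⁅ x ⁆ ∘ H⊆M-x)) , x∉p-x ∘ H⊆M-x

𝓗⇒∣p─H∣≤1 : ∀ {k s} {X M H : Subset n} → ∣ M ∣ ≡ suc k → p ⊆ M → X ⊆ p → ∣ p ∣ ≤ suc ∣ X ∣ →
            𝓗 k s X M H → ∣ p ─ H ∣ ≤ 1
𝓗⇒∣p─H∣≤1 {p = p} {H = H} _ _ X⊆p ∣p∣≤1+∣X∣ (_ , inj₁ (X⊆H , _)) = ∣p─q∣≤1 p H
  (≤-trans ∣p∣≤1+∣X∣ (s≤s (p⊆q⇒∣p∣≤∣q∣ λ y∈X → x∈p∩q⁺ (X⊆p y∈X , X⊆H y∈X))))
𝓗⇒∣p─H∣≤1 {p = p} {M = M} {H = H} ∣M∣≡1+k p⊆M _ _ (∣H∣≡k , inj₂ H⊆M) = begin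
  ∣ p ─ H ∣ ≤⟨ p⊆q⇒∣p∣≤∣q∣ (p⊆q⇒p─r⊆q─r {r = H} p⊆M) ⟩
  ∣ M ─ H ∣ ≤⟨ q⊆p⇒∣p─q∣≤1 ∣M∣≡1+k ∣H∣≡k H⊆M ⟩
  1         ∎
  where open ≤-Reasoning

𝓗-intersecting : ∀ r t k s (X M : Subset n) → ∣ M ∣ ≡ suc k → X ⊆ M → ∣ X ∣ < s →
                 t + r ≤ suc k → t + r ≤ 2 + ∣ X ∣ → RWiseTIntersecting r t (𝓗 k s X M)
𝓗-intersecting r t k s X M ∣M∣≡1+k X⊆M ∣X∣<s t+r≤1+k t+r≤2+∣X∣ F F∈𝓗
  with all? (λ i → F i ⊆? M)
... | yes F⊆M = ⋂ᶠ-lower-bound t M F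
  (λ i → q⊆p⇒∣p─q∣≤1 ∣M∣≡1+k (proj₁ (F∈𝓗 i)) (F⊆M i)) (subst (t + r ≤_) (sym ∣M∣≡1+k) t+r≤1+k)
... | no F⊈M with ¬∀⟶∃¬ r _ (λ i → F i ⊆? M) F⊈M
...   | i , Fi⊈M with proj₂ (F∈𝓗 i)
...     | inj₂ Fi⊆M = contradiction (λ {x} → Fi⊆M {x}) Fi⊈M
...     | inj₁ (X⊆Fi , s≤∣Fi∩M∣) =
  let S , X⊆S , S⊆Fi∩M , ∣S∣≡1+∣X∣ =
        ⊆-extend (suc ∣ X ∣) (λ y∈X → x∈p∩q⁺ (X⊆Fi y∈X , X⊆M y∈X)) (n≤1+n _) (≤-trans ∣X∣<s s≤∣Fi∩M∣)
      ∣S─F∣≤1 j = 𝓗⇒∣p─H∣≤1 ∣M∣≡1+k (p∩q⊆q _ _ ∘ S⊆Fi∩M) X⊆S (≤-reflexive ∣S∣≡1+∣X∣) (F∈𝓗 j)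
  in  ⋂ᶠ-lower-bound-⊆ t S F ∣S─F∣≤1 i (p∩q⊆p _ _ ∘ S⊆Fi∩M)
        (subst (λ m → t + r ≤ suc m) (sym ∣S∣≡1+∣X∣) t+r≤2+∣X∣)

lemma2p4 : (n k t r : ℕ) → 1 ≤ n → 1 ≤ k → 1 ≤ t → 2 ≤ r → 2 * k ≤ n
    → t + r ∸ 2 < k
    → (M X Z : Subset n)
    → ∣ M ∣ ≡ k + 1 → X ⊆ M → ∣ X ∣ ≡ t + r ∸ 2 → ∣ Z ∣ ≡ t + r
    → (RWiseTIntersecting r t (𝓐 k (t + r ∸ 1) Z) × NonTrivial t (𝓐 k (t + r ∸ 1) Z))
      × (RWiseTIntersecting r t (𝓗 k (t + r ∸ 1) X M) × NonTrivial t (𝓗 k (t + r ∸ 1) X M))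
lemma2p4 n k t r _ 1≤k 1≤t 2≤r 2k≤n 1+d≤k M X Z ∣M∣≡k+1 X⊆M ∣X∣≡d ∣Z∣≡t+r =
  ( 𝓐-intersecting r t k s Z (≤-reflexive ∣Z∣≡1+s) (≤-reflexive (sym ∣Z∣≡t+r))
  , 𝓐-nonTrivial t k s Z 1≤t s≤k 1+k≤n (≤-reflexive (sym ∣Z∣≡1+s)) )
  , ( 𝓗-intersecting r t k s X M ∣M∣≡1+k X⊆M ∣X∣<s t+r≤1+k t+r≤2+∣X∣
    , 𝓗-nonTrivial t k s X M 1≤t ∣M∣≡1+k )
  where
  s = t + r ∸ 1
  d = t + r ∸ 2
  t+r≡2+d : t + r ≡ 2 + d
  t+r≡2+d = sym (m+[n∸m]≡n (≤-trans 2≤r (m≤n+m r t)))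
  s≡1+d : s ≡ suc d
  s≡1+d = cong (_∸ 1) t+r≡2+d
  t+r≡1+s : t + r ≡ suc s
  t+r≡1+s = trans t+r≡2+d (cong suc (sym s≡1+d))
  ∣Z∣≡1+s : ∣ Z ∣ ≡ suc s
  ∣Z∣≡1+s = trans ∣Z∣≡t+r t+r≡1+s
  s≤k : s ≤ k
  s≤k = subst (_≤ k) (sym s≡1+d) 1+d≤k
  1+k≤n : suc k ≤ n
  1+k≤n = ≤-trans (+-mono-≤ 1≤k (m≤m+n k 0)) 2k≤n
  ∣M∣≡1+k : ∣ M ∣ ≡ suc k
  ∣M∣≡1+k = trans ∣M∣≡k+1 (+-comm k 1)
  ∣X∣<s : ∣ X ∣ < s
  ∣X∣<s = ≤-reflexive (trans (cong suc ∣X∣≡d) (sym s≡1+d))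
  t+r≤1+k : t + r ≤ suc k
  t+r≤1+k = ≤-trans (≤-reflexive t+r≡1+s) (s≤s s≤k)
  t+r≤2+∣X∣ : t + r ≤ 2 + ∣ X ∣
  t+r≤2+∣X∣ = ≤-reflexive (trans t+r≡2+d (cong (2 +_) (sym ∣X∣≡d)))
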